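{- Let $(T,\mathcal L,d,\downarrow)$ be a tuple system over a lattice $\mathcal L$, and let $\mathcal R_T$ be its information algebra of relations. Then $\mathcal R_T$ is adjoint: for all $U,W\in\mathcal L$, (i) for every relation $R\subseteq T_{U\vee W}$ one has $R\subseteq R^{\downarrow U}\otimes R^{\downarrow W}$; and (ii) for all relations $R_1\subseteq T_U$ and $R_2\subseteq T_W$ one has $(R_1\otimes R_2)^{\downarrow U}\subseteq R_1$ and $(R_1\otimes R_2)^{\downarrow W}\subseteq R_2$. Equivalently, for all $U,W$ the combination map $\otimes:\mathcal P(T_U)\times\mathcal P(T_W)\to\mathcal P(T_{U\vee W})$ is right adjoint (for the inclusion orders) to the map $R\mapsto(R^{\downarrow U},R^{\downarrow W})$.
   Context: A tuple system over a lattice $(\mathcal L,\le,\wedge,\vee)$ is a quadruple $(T,\mathcal L,d,\downarrow)$ where $T$ is a set, $d:T\to\mathcal L$ a function, and $x_{\downarrow U}\in T$ is defined for $x\in T$ and $U\le dx$, such that for $x,y\in T$, $U,W\in\mathcal L$: (T1) if $U\le dx$ then $d(x_{\downarrow U})=U$; (T2) if $W\le U\le dx$ then $(x_{\downarrow U})_{\downarrow W}=x_{\downarrow W}$; (T3) if $dx=U$ then $x_{\downarrow U}=x$; (T4) if $U=dx$, $W=dy$ and $x_{\downarrow U\wedge W}=y_{\downarrow U\wedge W}$, then there is $z\in T$ with $dz=U\vee W$, $z_{\downarrow U}=x$, $z_{\downarrow W}=y$; (T5) if $dx=U$ and $U\le W$ then there is $y\in T$ with $dy=W$ and $y_{\downarrow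 U}=x$. For $U\in\mathcal L$ put $T_U=\{x\in T: dx=U\}$. A relation over $U$ is a subset $R\subseteq T_U$, with domain $dR\defeq U$; the set of all relations is $\mathcal R_T=\coprod_{U\in\mathcal L}\mathcal P(T_U)$. For $U\le dR$, $R^{\downarrow U}\defeq\{x_{\downarrow U}:x\in R\}$. For relations $R,S$, $R\otimes S\defeq\{x\in T: dx=dR\vee dS,\ x_{\downarrow dR}\in R,\ x_{\downarrow dS}\in S\}$. Relations over the same domain are ordered by inclusion. -}

module Defs where

open import Level using (Level; _⊔_) renaming (suc to lsuc)
open import Algebra.Core using (Op₂)
open import Data.Product using (Σ; ∃; _×_; _,_; proj₁; proj₂)
open import Relation.Binary.Core using (Rel)
open import Relation.Binary.PropositionalEquality using (_≡_; refl; subst; sym)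
open import Relation.Binary.Lattice.Structures using (IsLattice)
open import Relation.Unary using (Pred; _⊆_)

record Lattice (a ℓ : Level) : Set (lsuc (a ⊔ ℓ)) where
  field
    Carrier   : Set a
    _≤_       : Rel Carrier ℓ
    _∨_       : Op₂ Carrier
    _∧_       : Op₂ Carrier
    isLattice : IsLattice _≡_ _≤_ _∨_ _∧_
  open IsLattice isLattice public

-- A tuple system (T, L, d, ↓) over a lattice L.
-- x ↓ U is defined for U ≤ d x; the proof of U ≤ d x is irrelevant,
-- so the restriction depends only on x and U.
record TupleSystem {a ℓ} (𝓛 : Lattice a ℓ) (t : Level) : Set (a ⊔ ℓ ⊔ lsuc t) where
  open Lattice 𝓛
  field
    T    : Set t
    d    : T → Carrier
    _↓_  : (x : T) (U : Carrier) → .(U ≤ d x) → T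
    T1 : ∀ (x : T) (U : Carrier) .(p : U ≤ d x) → d ((x ↓ U) p) ≡ U
    T2 : ∀ (x : T) (U W : Carrier) (q : W ≤ U) (p : U ≤ d x) →
         ((x ↓ U) p ↓ W) (subst (W ≤_) (sym (T1 x U p)) q) ≡ (x ↓ W) (IsLattice.trans isLattice q p)
    T3 : ∀ (x : T) (U : Carrier) (e : d x ≡ U) →
         (x ↓ U) (subst (U ≤_) (sym e) (IsLattice.refl isLattice)) ≡ x
    T4 : ∀ (x y : T) (U W : Carrier) (ex : d x ≡ U) (ey : d y ≡ W) →
         (x ↓ (U ∧ W)) (subst ((U ∧ W) ≤_) (sym ex) (x∧y≤x U W))
           ≡ (y ↓ (U ∧ W)) (subst ((U ∧ W) ≤_) (sym ey) (x∧y≤y U W)) →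
         Σ T λ z → Σ (d z ≡ U ∨ W) λ ez →
           ((z ↓ U) (subst (U ≤_) (sym ez) (x≤x∨y U W)) ≡ x)
           × ((z ↓ W) (subst (W ≤_) (sym ez) (y≤x∨y U W)) ≡ y)
    T5 : ∀ (x : T) (U W : Carrier) (ex : d x ≡ U) (q : U ≤ W) →
         Σ T λ y → Σ (d y ≡ W) λ ey →
           (y ↓ U) (subst (U ≤_) (sym ey) q) ≡ x

  T[_] : Carrier → Pred T a
  T[ U ] x = d x ≡ U

module Relations {a ℓ t} {𝓛 : Lattice a ℓ} (𝒯 : TupleSystem 𝓛 t) where
  open Lattice 𝓛
  open TupleSystem 𝒯

  record Relation (U : Carrier) (r : Level) : Set (a ⊔ t ⊔ lsuc r) where
    field
      mem : Pred T r
      sub : mem ⊆ T[ U ]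
  open Relation public

  _⊑_ : ∀ {U r s} → Relation U r → Relation U s → Set _
  R ⊑ S = mem R ⊆ mem S

  _⇓_ : ∀ {U r} (R : Relation U r) (W : Carrier) → W ≤ U → Relation W (t ⊔ r)
  mem ((R ⇓ W) q) y =
    Σ T λ x → Σ (mem R x) λ rx → y ≡ (x ↓ W) (subst (W ≤_) (sym (sub R rx)) q)
  sub ((R ⇓ W) q) (x , rx , refl) = T1 x W _

  _⊗_ : ∀ {U W r s} → Relation U r → Relation W s → Relation (U ∨ W) (a ⊔ r ⊔ s)
  mem (_⊗_ {U} {W} R S) x =
    Σ (d x ≡ U ∨ W) λ e →
      mem R ((x ↓ U) (subst (U ≤_) (sym e) (x≤x∨y U W)))
      × mem S ((x ↓ W) (subst (W ≤_) (sym e) (y≤x∨y U W)))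
  sub (R ⊗ S) (e , _) = e

{-# OPTIONS --safe #-}
module Submission where

-- Every tuple of R ⊆ T_{U∨W} is a common extension of its own two projections; conversely a
-- projection of a tuple of R₁ ⊗ R₂ is, by the definition of ⊗, already a member of R₁ (resp. R₂).

open import Defs
open import Level using (Level)
open import Data.Product using (_×_; _,_)
open import Relation.Binary.PropositionalEquality using (refl; subst; sym)

module _ {a ℓ t} {𝓛 : Lattice a ℓ} (𝒯 : TupleSystem 𝓛 t) where
  open Lattice 𝓛 using (_∨_; x≤x∨y; y≤x∨y)
  open Relations 𝒯

  ⊑-⇓⊗⇓ : ∀ {U W r} (R : Relation (U ∨ W) r) →
          R ⊑ ((R ⇓ U) (x≤x∨y U W) ⊗ (R ⇓ W) (y≤x∨y U W))
  ⊑-⇓⊗⇓ R {x} x∈R = sub R x∈R , (x , x∈R , refl) , (x , x∈R , refl)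

  ⊗-⇓ˡ-⊑ : ∀ {U W r s} (R₁ : Relation U r) (R₂ : Relation W s) →
           ((R₁ ⊗ R₂) ⇓ U) (x≤x∨y U W) ⊑ R₁
  ⊗-⇓ˡ-⊑ R₁ R₂ (x , (_ , x↓U∈R₁ , _) , y≡x↓U) = subst (mem R₁) (sym y≡x↓U) x↓U∈R₁

  ⊗-⇓ʳ-⊑ : ∀ {U W r s} (R₁ : Relation U r) (R₂ : Relation W s) →
           ((R₁ ⊗ R₂) ⇓ W) (y≤x∨y U W) ⊑ R₂
  ⊗-⇓ʳ-⊑ R₁ R₂ (x , (_ , _ , x↓W∈R₂) , y≡x↓W) = subst (mem R₂) (sym y≡x↓W) x↓W∈R₂

theorem4 : ∀ {a ℓ t : Level} (𝓛 : Lattice a ℓ) (𝒯 : TupleSystem 𝓛 t) (r : Level) →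
    let open Lattice 𝓛 in
    let open Relations 𝒯 in
    ∀ (U W : Carrier) →
      ((R : Relation (U ∨ W) r) →
        R ⊑ ((R ⇓ U) (x≤x∨y U W) ⊗ (R ⇓ W) (y≤x∨y U W)))
      × ((R₁ : Relation U r) (R₂ : Relation W r) →
        ((R₁ ⊗ R₂) ⇓ U) (x≤x∨y U W) ⊑ R₁
        × ((R₁ ⊗ R₂) ⇓ W) (y≤x∨y U W) ⊑ R₂)
theorem4 𝓛 𝒯 r U W =
  ⊑-⇓⊗⇓ 𝒯 , λ R₁ R₂ → ⊗-⇓ˡ-⊑ 𝒯 R₁ R₂ , ⊗-⇓ʳ-⊑ 𝒯 R₁ R₂
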